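{- Let $k\in\mathbb{Z}^+$ and $n\ge 2k+1$. For every $i\in[n-1]$, among all permutations $\pi\in\mathcal{S}_n$ with $\{\pi^k(i),\pi^k(i+1)\}\neq\{i,i+1\}$, exactly half satisfy $\pi^k(i)>\pi^k(i+1)$ and exactly half satisfy $\pi^k(i)<\pi^k(i+1)$.
   Context: $\mathcal{S}_n$ is the symmetric group on $[n]=\{1,\dots,n\}$. -}

module Defs where

open import Data.Nat using (ℕ; zero; suc)
open import Data.Fin using (Fin; zero; suc; inject₁; _<_; _>_; _≟_)
open import Data.Fin.Properties using (<-cmp)
open import Data.Fin.Properties as FinP using ()
open import Data.Vec using (Vec; []; _∷_; lookup; toList)
open import Data.List using (List; []; _∷_; [_]; map; concatMap; filter; length; allFin)
open import Data.List.Relation.Unary.Unique.Propositional using (Unique)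
open import Data.List.Relation.Unary.AllPairs using (allPairs?)
open import Data.Product using (_×_; _,_)
open import Data.Sum using (_⊎_)
open import Relation.Binary.PropositionalEquality using (_≡_)
open import Relation.Nullary using (Dec; ¬_; ¬?)
open import Relation.Nullary.Decidable using (_×-dec_; _⊎-dec_)
open import Relation.Unary using (Decidable)

-- A permutation of [n] (0-indexed: Fin n) is represented by its one-line
-- notation: a vector v with π(j) = lookup v j, whose entries are pairwise distinct.
IsPerm : ∀ {n} → Vec (Fin n) n → Set
IsPerm v = Unique (toList v)

isPerm? : ∀ {n} → Decidable (IsPerm {n})
isPerm? v = allPairs? (λ x y → ¬? (x ≟ y)) (toList v)

allVecs : ∀ m n → List (Vec (Fin n) m)
allVecs zero    n = [ [] ]
allVecs (suc m) n = concatMap (λ x → map (x ∷_) (allVecs m n)) (allFin n)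

Sym : ∀ n → List (Vec (Fin n) n)
Sym n = filter isPerm? (allVecs n n)

_^[_] : ∀ {n} → Vec (Fin n) n → ℕ → Fin n → Fin n
(v ^[ zero ]) j  = j
(v ^[ suc k ]) j = lookup v ((v ^[ k ]) j)

SetNeq : ∀ {n} → ℕ → Fin n → Fin n → Vec (Fin n) n → Set
SetNeq k a b v = ¬ (((v ^[ k ]) a ≡ a × (v ^[ k ]) b ≡ b) ⊎ ((v ^[ k ]) a ≡ b × (v ^[ k ]) b ≡ a))

setNeq? : ∀ {n} k (a b : Fin n) → Decidable (SetNeq k a b)
setNeq? k a b v = ¬? ((((v ^[ k ]) a ≟ a) ×-dec ((v ^[ k ]) b ≟ b)) ⊎-dec (((v ^[ k ]) a ≟ b) ×-dec ((v ^[ k ]) b ≟ a)))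

Desc : ∀ {n} → ℕ → Fin n → Fin n → Vec (Fin n) n → Set
Desc k a b v = (v ^[ k ]) a > (v ^[ k ]) b

desc? : ∀ {n} k (a b : Fin n) → Decidable (Desc k a b)
desc? k a b v = (v ^[ k ]) b FinP.<? (v ^[ k ]) a

Asc : ∀ {n} → ℕ → Fin n → Fin n → Vec (Fin n) n → Set
Asc k a b v = (v ^[ k ]) a < (v ^[ k ]) b

asc? : ∀ {n} k (a b : Fin n) → Decidable (Asc k a b)
asc? k a b v = (v ^[ k ]) a FinP.<? (v ^[ k ]) b

{-# OPTIONS --safe #-}

-- Conjugation by the adjacent transposition τ = (i i+1) is an involution of S_n
-- with (τπτ)^k = τπ^kτ.  It therefore preserves the condition
-- {π^k(i), π^k(i+1)} ≠ {i, i+1}, and since τ preserves the relative order of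
-- every pair of points other than {i, i+1}, it exchanges the permutations with
-- π^k(i) < π^k(i+1) and those with π^k(i) > π^k(i+1).  These two classes have
-- equal size and, π^k being injective, partition the permutations in question.

module Submission where

open import Defs
open import Data.Nat using (ℕ; suc; _+_; _*_; _≤_)
open import Data.Fin using (Fin; inject₁)
open import Data.List using (filter; length)
open import Data.Product using (_×_)
open import Relation.Binary.PropositionalEquality using (_≡_)

open import Level using (0ℓ)
open import Algebra.Definitions using (Involutive; SelfInverse)
open import Algebra.Consequences.Propositional using (selfInverse⇒involutive; selfInverse⇒injective)
open import Function.Base using (_∘_)
open import Function.Bundles using (_⇔_; mk⇔; Equivalence)
open import Function.Definitions using (Injective)
open import Data.Nat.Base as ℕ using (zero; s≤s⁻¹)
open import Data.Nat.Properties using (+-suc; +-identityʳ)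
open import Data.Fin.Base as F using (suc; toℕ; _<_)
open import Data.Fin.Properties
  using (_≟_; <-cmp; <-asym; <-trans; <⇒≢; ≤∧≢⇒<; ≤̄⇒inject₁<; ≤-refl; toℕ-inject₁)
open import Data.Fin.Permutation.Components using (transpose)
open import Data.Vec.Base using (Vec; []; _∷_; lookup; tabulate; toList)
open import Data.Vec.Properties using (lookup∘tabulate; tabulate∘lookup; tabulate-cong; ∷-injective)
open import Data.Vec.Relation.Unary.All.Properties using (toList⁺; toList⁻)
open import Data.Vec.Relation.Unary.AllPairs using ([]; _∷_)
import Data.Vec.Relation.Unary.Unique.Propositional as Vec
open import Data.Vec.Relation.Unary.Unique.Propositional.Properties using (lookup-injective; tabulate⁺)
open import Data.List.Base using ([]; _∷_; _++_; map; concatMap; cartesianProductWith; allFin)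
open import Data.List.Properties using (length-map)
open import Data.List.Membership.Propositional using (_∈_)
open import Data.List.Membership.Propositional.Properties
  using (∈-map⁺; ∈-map⁻; ∈-filter⁺; ∈-filter⁻; ∈-allFin; ∈-cartesianProductWith⁺)
open import Data.List.Membership.Propositional.Properties.WithK using (unique∧set⇒bag)
open import Data.List.Relation.Binary.BagAndSetEquality using (∼bag⇒↭)
open import Data.List.Relation.Binary.Permutation.Propositional using (_↭_; ↭-trans; ↭-reflexive)
open import Data.List.Relation.Binary.Permutation.Propositional.Properties using (filter-↭; ↭-length)
open import Data.List.Relation.Unary.All as All using (All; []; _∷_)
import Data.List.Relation.Unary.All.Properties as Allₚ
open import Data.List.Relation.Unary.AllPairs using ([]; _∷_)
open import Data.List.Relation.Unary.Any using (here)
open import Data.List.Relation.Unary.Unique.Propositional using (Unique)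
open import Data.List.Relation.Unary.Unique.Propositional.Properties
  using (filter⁺; map⁺; allFin⁺; cartesianProductWith⁺)
open import Data.Product using (_,_; proj₂)
open import Data.Sum using (_⊎_; inj₁; inj₂)
open import Relation.Binary.Definitions using (tri<; tri≈; tri>)
open import Relation.Binary.PropositionalEquality
  using (_≢_; refl; sym; trans; cong; subst; subst₂; module ≡-Reasoning)
open import Relation.Nullary using (¬_; yes; no; contradiction)
open import Relation.Unary using (Pred; Decidable)
open import Relation.Unary.Properties using (∁?)

module _ {A : Set} {P : Pred A 0ℓ} (P? : Decidable P) where

  filter-cong-All : ∀ {Q : Pred A 0ℓ} (Q? : Decidable Q) {xs} →
                    All (λ x → P x ⇔ Q x) xs → filter P? xs ≡ filter Q? xs
  filter-cong-All Q? {[]}     []                = refl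
  filter-cong-All Q? {x ∷ xs} (Px⇔Qx ∷ Pxs⇔Qxs) with P? x | Q? x
  ... | yes _   | yes _  = cong (x ∷_) (filter-cong-All Q? Pxs⇔Qxs)
  ... | yes Px  | no ¬Qx = contradiction (Equivalence.to Px⇔Qx Px) ¬Qx
  ... | no  ¬Px | yes Qx = contradiction (Equivalence.from Px⇔Qx Qx) ¬Px
  ... | no  _   | no  _  = filter-cong-All Q? Pxs⇔Qxs

  length-filter-+-∁ : ∀ xs → length (filter P? xs) + length (filter (∁? P?) xs) ≡ length xs
  length-filter-+-∁ []       = refl
  length-filter-+-∁ (x ∷ xs) with P? x
  ... | yes _ = cong suc (length-filter-+-∁ xs)
  ... | no  _ = trans (+-suc _ _) (cong suc (length-filter-+-∁ xs))

  filter-map : ∀ {B : Set} (f : B → A) xs → filter P? (map f xs) ≡ map f (filter (P? ∘ f) xs)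
  filter-map f []       = refl
  filter-map f (x ∷ xs) with P? (f x)
  ... | yes _ = cong (f x ∷_) (filter-map f xs)
  ... | no  _ = filter-map f xs

module _ {A : Set} {f : A → A} where

  ↭-map-selfInverse : SelfInverse _≡_ f → ∀ {xs} → Unique xs → (∀ {x} → x ∈ xs → f x ∈ xs) →
                      xs ↭ map f xs
  ↭-map-selfInverse f-selfInverse {xs} xs-unique closed =
    ∼bag⇒↭ (unique∧set⇒bag xs-unique fxs-unique (mk⇔ to from))
    where
    fxs-unique = map⁺ (selfInverse⇒injective f-selfInverse) xs-unique
    to : ∀ {x} → x ∈ xs → x ∈ map f xs
    to {x} x∈xs = subst (_∈ map f xs) (selfInverse⇒involutive f-selfInverse x) (∈-map⁺ f (closed x∈xs))
    from : ∀ {x} → x ∈ map f xs → x ∈ xs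
    from x∈fxs with ∈-map⁻ f x∈fxs
    ... | _ , y∈xs , refl = closed y∈xs

  module _ {P : Pred A 0ℓ} (P? : Decidable P) {xs} (xs↭fxs : xs ↭ map f xs) where

    filter-↭-map-filter : filter P? xs ↭ map f (filter (P? ∘ f) xs)
    filter-↭-map-filter = ↭-trans (filter-↭ P? xs↭fxs) (↭-reflexive (filter-map P? f xs))

    filter-↭-map : All (λ x → P x ⇔ P (f x)) xs → filter P? xs ↭ map f (filter P? xs)
    filter-↭-map P⇔Pf =
      ↭-trans filter-↭-map-filter (↭-reflexive (cong (map f) (sym (filter-cong-All P? (P? ∘ f) P⇔Pf))))

    length-filter-↭-map : ∀ {Q : Pred A 0ℓ} (Q? : Decidable Q) →
                          All (λ x → Q x ⇔ P (f x)) xs → length (filter P? xs) ≡ length (filter Q? xs)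
    length-filter-↭-map Q? Q⇔Pf = begin
      length (filter P? xs)               ≡⟨ ↭-length filter-↭-map-filter ⟩
      length (map f (filter (P? ∘ f) xs)) ≡⟨ length-map f (filter (P? ∘ f) xs) ⟩
      length (filter (P? ∘ f) xs)         ≡⟨ cong length (filter-cong-All Q? (P? ∘ f) Q⇔Pf) ⟨
      length (filter Q? xs)               ∎
      where open ≡-Reasoning

concatMap-map≡cartesianProductWith : ∀ {A B C : Set} (f : A → B → C) xs ys →
                                     concatMap (λ x → map (f x) ys) xs ≡ cartesianProductWith f xs ys
concatMap-map≡cartesianProductWith f []       ys = refl
concatMap-map≡cartesianProductWith f (x ∷ xs) ys =
  cong (map (f x) ys ++_) (concatMap-map≡cartesianProductWith f xs ys)

allVecs-suc : ∀ m n → allVecs (suc m) n ≡ cartesianProductWith _∷_ (allFin n) (allVecs m n)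
allVecs-suc m n = concatMap-map≡cartesianProductWith _∷_ (allFin n) (allVecs m n)

∈-allVecs : ∀ {m n} (v : Vec (Fin n) m) → v ∈ allVecs m n
∈-allVecs []                  = here refl
∈-allVecs {suc m} {n} (x ∷ v) =
  subst (x ∷ v ∈_) (sym (allVecs-suc m n)) (∈-cartesianProductWith⁺ _∷_ (∈-allFin x) (∈-allVecs v))

allVecs-unique : ∀ m n → Unique (allVecs m n)
allVecs-unique zero    n = [] ∷ []
allVecs-unique (suc m) n =
  subst Unique (sym (allVecs-suc m n)) (cartesianProductWith⁺ _∷_ ∷-injective (allFin⁺ n) (allVecs-unique m n))

module _ {A : Set} where

  toList-unique⁺ : ∀ {n} {xs : Vec A n} → Vec.Unique xs → Unique (toList xs)
  toList-unique⁺ []                 = []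
  toList-unique⁺ (x∉xs ∷ xs-unique) = toList⁺ x∉xs ∷ toList-unique⁺ xs-unique

  toList-unique⁻ : ∀ {n} {xs : Vec A n} → Unique (toList xs) → Vec.Unique xs
  toList-unique⁻ {xs = []}    []                 = []
  toList-unique⁻ {xs = _ ∷ _} (x∉xs ∷ xs-unique) = toList⁻ x∉xs ∷ toList-unique⁻ xs-unique

module _ {n : ℕ} where

  isPerm⇒lookup-injective : ∀ {v : Vec (Fin n) n} → IsPerm v → Injective _≡_ _≡_ (lookup v)
  isPerm⇒lookup-injective v-perm = lookup-injective (toList-unique⁻ v-perm) _ _

  tabulate-isPerm : ∀ {g : Fin n → Fin n} → Injective _≡_ _≡_ g → IsPerm (tabulate g)
  tabulate-isPerm g-injective = toList-unique⁺ (tabulate⁺ g-injective)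

  ^-injective : ∀ {v : Vec (Fin n) n} → IsPerm v → ∀ k → Injective _≡_ _≡_ (v ^[ k ])
  ^-injective v-perm zero    eq = eq
  ^-injective v-perm (suc k) eq = ^-injective v-perm k (isPerm⇒lookup-injective v-perm eq)

  ∈-Sym⁺ : ∀ {v} → IsPerm v → v ∈ Sym n
  ∈-Sym⁺ {v} = ∈-filter⁺ isPerm? (∈-allVecs v)

  ∈-Sym⁻ : ∀ {v} → v ∈ Sym n → IsPerm v
  ∈-Sym⁻ = proj₂ ∘ ∈-filter⁻ isPerm? {xs = allVecs n n}

  Sym-unique : Unique (Sym n)
  Sym-unique = filter⁺ isPerm? (allVecs-unique n n)

  Sym-isPerm : All IsPerm (Sym n)
  Sym-isPerm = Allₚ.all-filter isPerm? (allVecs n n)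

conjugate : ∀ {n} → (Fin n → Fin n) → Vec (Fin n) n → Vec (Fin n) n
conjugate σ v = tabulate (σ ∘ lookup v ∘ σ)

lookup-conjugate : ∀ {n} (σ : Fin n → Fin n) v j → lookup (conjugate σ v) j ≡ σ (lookup v (σ j))
lookup-conjugate σ v = lookup∘tabulate (σ ∘ lookup v ∘ σ)

module _ {n} {σ : Fin n → Fin n} (σ-selfInverse : SelfInverse _≡_ σ) where

  private
    σ-involutive : Involutive _≡_ σ
    σ-involutive = selfInverse⇒involutive σ-selfInverse

  conjugate-selfInverse : SelfInverse _≡_ (conjugate σ)
  conjugate-selfInverse {v} refl = begin
    tabulate (σ ∘ lookup (conjugate σ v) ∘ σ) ≡⟨ tabulate-cong σσvσσ≗v ⟩
    tabulate (lookup v)                       ≡⟨ tabulate∘lookup v ⟩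
    v                                         ∎
    where
    open ≡-Reasoning
    σσvσσ≗v : ∀ j → σ (lookup (conjugate σ v) (σ j)) ≡ lookup v j
    σσvσσ≗v j = trans (cong σ (lookup-conjugate σ v (σ j)))
                      (trans (σ-involutive _) (cong (lookup v) (σ-involutive j)))

  ^-conjugate : ∀ v k j → (conjugate σ v ^[ k ]) j ≡ σ ((v ^[ k ]) (σ j))
  ^-conjugate v zero    j = sym (σ-involutive j)
  ^-conjugate v (suc k) j = begin
    lookup (conjugate σ v) ((conjugate σ v ^[ k ]) j) ≡⟨ cong (lookup (conjugate σ v)) (^-conjugate v k j) ⟩
    lookup (conjugate σ v) (σ ((v ^[ k ]) (σ j)))     ≡⟨ lookup-conjugate σ v _ ⟩
    σ (lookup v (σ (σ ((v ^[ k ]) (σ j)))))           ≡⟨ cong (σ ∘ lookup v) (σ-involutive _) ⟩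
    σ (lookup v ((v ^[ k ]) (σ j)))                   ∎
    where open ≡-Reasoning

  conjugate-isPerm : ∀ {v} → IsPerm v → IsPerm (conjugate σ v)
  conjugate-isPerm v-perm = tabulate-isPerm (σ-injective ∘ isPerm⇒lookup-injective v-perm ∘ σ-injective)
    where σ-injective = selfInverse⇒injective σ-selfInverse

  Sym-↭-map-conjugate : Sym n ↭ map (conjugate σ) (Sym n)
  Sym-↭-map-conjugate =
    ↭-map-selfInverse conjugate-selfInverse Sym-unique (∈-Sym⁺ ∘ conjugate-isPerm ∘ ∈-Sym⁻)

-- SetNeq k a b v unfolds to ¬ SamePair a b ((v ^[ k ]) a) ((v ^[ k ]) b).
SamePair : ∀ {n} → Fin n → Fin n → Fin n → Fin n → Set
SamePair a b x y = (x ≡ a × y ≡ b) ⊎ (x ≡ b × y ≡ a)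

module _ {n} (a b : Fin n) where

  transpose-matchˡ : transpose a b a ≡ b
  transpose-matchˡ with a ≟ a
  ... | yes _   = refl
  ... | no  a≢a = contradiction refl a≢a

  transpose-matchʳ : transpose a b b ≡ a
  transpose-matchʳ with b ≟ a
  ... | yes b≡a = b≡a
  ... | no  _   with b ≟ b
  ...   | yes _   = refl
  ...   | no  b≢b = contradiction refl b≢b

  transpose-fix : ∀ {x} → x ≢ a → x ≢ b → transpose a b x ≡ x
  transpose-fix {x} x≢a x≢b with x ≟ a
  ... | yes x≡a = contradiction x≡a x≢a
  ... | no  _   with x ≟ b
  ...   | yes x≡b = contradiction x≡b x≢b
  ...   | no  _   = refl

  transpose-selfInverse : SelfInverse _≡_ (transpose a b)
  transpose-selfInverse {x} refl with x ≟ a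
  ... | yes refl = transpose-matchʳ
  ... | no  x≢a  with x ≟ b
  ...   | yes refl = transpose-matchˡ
  ...   | no  x≢b  = transpose-fix x≢a x≢b

  private
    τ = transpose a b

  samePair-sym : ∀ {x y} → SamePair a b x y → SamePair a b y x
  samePair-sym (inj₁ (x≡a , y≡b)) = inj₂ (y≡b , x≡a)
  samePair-sym (inj₂ (x≡b , y≡a)) = inj₁ (y≡a , x≡b)

  samePair-transpose : ∀ {x y} → SamePair a b (τ y) (τ x) → SamePair a b x y
  samePair-transpose (inj₁ (τy≡a , τx≡b)) =
    inj₁ (trans (sym (transpose-selfInverse τx≡b)) transpose-matchʳ ,
          trans (sym (transpose-selfInverse τy≡a)) transpose-matchˡ)
  samePair-transpose (inj₂ (τy≡b , τx≡a)) =
    inj₂ (trans (sym (transpose-selfInverse τx≡a)) transpose-matchˡ ,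
          trans (sym (transpose-selfInverse τy≡b)) transpose-matchʳ)

  ^-conjugate-transposeˡ : ∀ v k → (conjugate τ v ^[ k ]) a ≡ τ ((v ^[ k ]) b)
  ^-conjugate-transposeˡ v k =
    trans (^-conjugate transpose-selfInverse v k a) (cong (τ ∘ (v ^[ k ])) transpose-matchˡ)

  ^-conjugate-transposeʳ : ∀ v k → (conjugate τ v ^[ k ]) b ≡ τ ((v ^[ k ]) a)
  ^-conjugate-transposeʳ v k =
    trans (^-conjugate transpose-selfInverse v k b) (cong (τ ∘ (v ^[ k ])) transpose-matchʳ)

  setNeq-conjugate : ∀ k v → SetNeq k a b v ⇔ SetNeq k a b (conjugate τ v)
  setNeq-conjugate k v rewrite ^-conjugate-transposeˡ v k | ^-conjugate-transposeʳ v k =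
    mk⇔ (λ ¬pair → ¬pair ∘ samePair-transpose)
        (λ ¬τpair → ¬τpair ∘ samePair-transpose ∘ subst₂ (SamePair a b) (id≡ττ p) (id≡ττ q))
    where
    id≡ττ = sym ∘ selfInverse⇒involutive transpose-selfInverse
    p = (v ^[ k ]) a
    q = (v ^[ k ]) b

≢∧≯⇒< : ∀ {n} {x y : Fin n} → x ≢ y → ¬ y < x → x < y
≢∧≯⇒< {x = x} {y} x≢y y≮x with <-cmp x y
... | tri< x<y _ _ = x<y
... | tri≈ _ x≡y _ = contradiction x≡y x≢y
... | tri> _ _ y<x = contradiction y<x y≮x

inject₁<suc : ∀ {m} (i : Fin m) → inject₁ i < suc i
inject₁<suc i = ≤̄⇒inject₁< ≤-refl

inject₁<⇒suc≤ : ∀ {m} {i : Fin m} {x : Fin (suc m)} → inject₁ i < x → suc i F.≤ x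
inject₁<⇒suc≤ {i = i} {x} = subst (ℕ._< toℕ x) (toℕ-inject₁ i)

<suc⇒≤inject₁ : ∀ {m} {i : Fin m} {x : Fin (suc m)} → x < suc i → x F.≤ inject₁ i
<suc⇒≤inject₁ {i = i} {x} = subst (toℕ x ℕ.≤_) (sym (toℕ-inject₁ i)) ∘ s≤s⁻¹

module _ {m} (i : Fin m) where

  private
    τ = transpose (inject₁ i) (suc i)

  transpose-adjacent-mono-< : ∀ {p q} → ¬ (p ≡ inject₁ i × q ≡ suc i) → p < q → τ p < τ q
  transpose-adjacent-mono-< {p} {q} ¬ab p<q with q ≟ inject₁ i
  ... | yes refl = subst (_< suc i) (sym (transpose-fix _ _ (<⇒≢ p<q) (<⇒≢ p<1+i))) p<1+i
    where p<1+i = <-trans p<q (inject₁<suc i)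
  ... | no _ with q ≟ suc i
  ...   | yes refl =
    subst (_< inject₁ i) (sym (transpose-fix _ _ p≢i (<⇒≢ p<q))) (≤∧≢⇒< (<suc⇒≤inject₁ p<q) p≢i)
    where p≢i = λ p≡i → ¬ab (p≡i , refl)
  ...   | no q≢1+i with p ≟ inject₁ i
  ...     | yes refl = ≤∧≢⇒< (inject₁<⇒suc≤ p<q) (q≢1+i ∘ sym)
  ...     | no _ with p ≟ suc i
  ...       | yes refl = <-trans (inject₁<suc i) p<q
  ...       | no _     = p<q

  asc⇔desc-conjugate : ∀ k v → SetNeq k (inject₁ i) (suc i) v →
                       Asc k (inject₁ i) (suc i) v ⇔ Desc k (inject₁ i) (suc i) (conjugate τ v)
  asc⇔desc-conjugate k v ¬pair
    rewrite ^-conjugate-transposeˡ (inject₁ i) (suc i) v k | ^-conjugate-transposeʳ (inject₁ i) (suc i) v k =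
    mk⇔ (transpose-adjacent-mono-< (¬pair ∘ inj₁))
        (subst₂ _<_ (involutive p) (involutive q) ∘ transpose-adjacent-mono-< ¬τpair)
    where
    involutive = selfInverse⇒involutive (transpose-selfInverse (inject₁ i) (suc i))
    p = (v ^[ k ]) (inject₁ i)
    q = (v ^[ k ]) (suc i)
    ¬τpair = ¬pair ∘ samePair-sym _ _ ∘ samePair-transpose _ _ ∘ inj₁

asc⇔¬desc : ∀ {n} k {a b : Fin n} {v} → IsPerm v → a ≢ b → Asc k a b v ⇔ (¬ Desc k a b v)
asc⇔¬desc k v-perm a≢b = mk⇔ <-asym (≢∧≯⇒< (a≢b ∘ ^-injective v-perm k))

equal-halves : ∀ {d c s} → d ≡ c → d + c ≡ s → 2 * d ≡ s × 2 * c ≡ s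
equal-halves {d} refl d+d≡s = 2*d≡s , 2*d≡s
  where 2*d≡s = trans (cong (d +_) (+-identityʳ d)) d+d≡s

lemma2p2 : (k m : ℕ) → 1 ≤ k → 2 * k + 1 ≤ suc m → (i : Fin m) →
    (2 * length (filter (desc? k (inject₁ i) (Fin.suc i)) (filter (setNeq? k (inject₁ i) (Fin.suc i)) (Sym (suc m))))
      ≡ length (filter (setNeq? k (inject₁ i) (Fin.suc i)) (Sym (suc m))))
    × (2 * length (filter (asc? k (inject₁ i) (Fin.suc i)) (filter (setNeq? k (inject₁ i) (Fin.suc i)) (Sym (suc m))))
      ≡ length (filter (setNeq? k (inject₁ i) (Fin.suc i)) (Sym (suc m))))
lemma2p2 k m _ _ i = equal-halves #desc≡#asc #desc+#asc≡#NS
  where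
  a = inject₁ i
  b = suc i
  τ-selfInverse = transpose-selfInverse a b
  NS = filter (setNeq? k a b) (Sym (suc m))

  NS↭τNSτ : NS ↭ map (conjugate (transpose a b)) NS
  NS↭τNSτ = filter-↭-map (setNeq? k a b) (Sym-↭-map-conjugate τ-selfInverse)
              (All.universal (setNeq-conjugate a b k) (Sym (suc m)))

  #desc≡#asc : length (filter (desc? k a b) NS) ≡ length (filter (asc? k a b) NS)
  #desc≡#asc = length-filter-↭-map (desc? k a b) NS↭τNSτ (asc? k a b)
                 (All.map (asc⇔desc-conjugate i k _) (Allₚ.all-filter (setNeq? k a b) (Sym (suc m))))

  asc≡¬desc : filter (asc? k a b) NS ≡ filter (∁? (desc? k a b)) NS
  asc≡¬desc = filter-cong-All (asc? k a b) (∁? (desc? k a b))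
                (All.map (λ v-perm → asc⇔¬desc k v-perm (<⇒≢ (inject₁<suc i)))
                         (Allₚ.filter⁺ (setNeq? k a b) Sym-isPerm))

  #desc+#asc≡#NS : length (filter (desc? k a b) NS) + length (filter (asc? k a b) NS) ≡ length NS
  #desc+#asc≡#NS = trans (cong (λ xs → length (filter (desc? k a b) NS) + length xs) asc≡¬desc)
                         (length-filter-+-∁ (desc? k a b) NS)
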